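{- Let $G=(V,A,s)$ be an acyclic flow graph. Run Algorithm AD (Version 1) on $G$. Then, for every choice of spanning tree, bottom-up numbering, and order in which unmarked arcs are selected, the algorithm terminates and, for every vertex $w\ne s$, it assigns a value to $d(w)$ that equals the immediate dominator of $w$ in $G$.
   Context: A flow graph $G=(V,A,s)$ is a finite directed graph with start vertex $s$ from which every vertex is reachable; assume $n=|V|>1$, no arcs enter $s$, and $G$ has no multiple arcs and no loop arcs. $G$ is acyclic if it contains no cycle of more than one vertex. A vertex $x$ dominates $y$ if every path from $s$ to $y$ contains $x$; the immediate dominator of $y\neq s$ is the unique dominator $d(y)\ne y$ of $y$ dominated by all dominators of $y$ other than $y$. For a spanning tree with parent function $p$, an arc $(x,w)$ is a tree arc if $x=p(w)$, a forward arc if $x$ is a proper ancestor of $p(w)$, a back arc if $x$ is a proper descendant of $w$, a cross arc if $x,w$ are unrelated, a loop arc if $x=w$. Contracting $v$ into $p(v)$ replaces every arc end equal to $v$ by $p(v)$ (arcs $(p(v),v)$, $(v,p(v))$ and $(v,v)$ become loop arcs $(p(v),p(v))$), deletes $v$, and updates the current spanning tree so that the former children of $v$ become children of $p(v)$; each arc produced by a contraction is marked iff the arc it replaces was marked. Algorithm AD (Version 1): Initialization: choose any spanning tree $T$ of $G$ rooted at $s$ with parent function $p$; number the vertices $1,\dots,n$ so that $x<p(x)$ for all $x\ne s$ (bottom-up order) and identify vertices with numbers; unmark all arcs; set $\mathit{same}(x)=\{x\}$ for every $x$. Main loop: for $u=1,\dots,n$: while some tree or forward arc $(u,v)$ (with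 respect to the current tree and current graph) is unmarked: mark $(u,v)$; if all arcs into $v$ are marked, then (if $u=p(v)$ then set $d(w)\leftarrow u$ for every $w\in\mathit{same}(v)$, else set $\mathit{same}(p(v))\leftarrow\mathit{same}(p(v))\cup\mathit{same}(v)$) and contract $v$ into $p(v)$, where $p$ denotes the current parent function. -}

module Defs where

open import Data.Nat using (ℕ; zero; suc; _<_; _≤_)
open import Data.Fin using (Fin; toℕ; fromℕ; _≟_)
open import Data.Bool using (Bool; true; false; if_then_else_; _∨_)
open import Data.Maybe using (Maybe; just; nothing)
open import Data.Product using (Σ; ∃; _×_; _,_)
open import Data.Sum using (_⊎_)
open import Relation.Nullary using (¬_)
open import Relation.Nullary.Decidable using (⌊_⌋)
open import Relation.Binary.PropositionalEquality using (_≡_; _≢_)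
open import Relation.Binary.Construct.Closure.Transitive using (TransClosure)
open import Relation.Binary.Construct.Closure.ReflexiveTransitive using (Star)

-- Graphs on the vertex set Fin n.  A graph is a Boolean adjacency
-- matrix (so there are no multiple arcs).  Arc A x y : there is an arc x → y.

Arc : {n : ℕ} → (Fin n → Fin n → Bool) → Fin n → Fin n → Set
Arc A x y = A x y ≡ true

-- Walks (paths in the sense of the paper) from x to y.
data Path {n : ℕ} (A : Fin n → Fin n → Bool) : Fin n → Fin n → Set where
  []  : ∀ {x} → Path A x x
  _∷_ : ∀ {x y z} → Arc A x y → Path A y z → Path A x z

visits : ∀ {n} {A : Fin n → Fin n → Bool} {x y : Fin n} → Fin n → Path A x y → Set
visits {x = x} v []            = v ≡ x
visits {x = x} v (_∷_ _ rest)  = v ≡ x ⊎ visits v rest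

Dominates : ∀ {n} → (Fin n → Fin n → Bool) → Fin n → Fin n → Fin n → Set
Dominates A s x y = (P : Path A s y) → visits x P

IsIdom : ∀ {n} → (Fin n → Fin n → Bool) → Fin n → Fin n → Fin n → Set
IsIdom A s i y =
  Dominates A s i y × i ≢ y ×
  (∀ z → Dominates A s z y → z ≢ y → Dominates A s z i)

IsFlowGraph : (m : ℕ) → (Fin (suc m) → Fin (suc m) → Bool) → Set
IsFlowGraph m A =
  1 ≤ m ×
  (∀ x → A x (fromℕ m) ≡ false) ×
  (∀ x → A x x ≡ false) ×
  (∀ v → Star (Arc A) (fromℕ m) v)

Acyclic : ∀ {n} → (Fin n → Fin n → Bool) → Set
Acyclic A = ∀ x → ¬ TransClosure (Arc A) x x

-- p is the parent function of a spanning tree of A rooted at s = fromℕ m,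
-- and the identity numbering is bottom-up: x < p(x) for x ≠ s.
IsBottomUpSpanningTree : (m : ℕ) → (Fin (suc m) → Fin (suc m) → Bool)
                       → (Fin (suc m) → Fin (suc m)) → Set
IsBottomUpSpanningTree m A p =
  ∀ x → x ≢ fromℕ m → Arc A (p x) x × toℕ x < toℕ (p x)

-- Algorithm AD (Version 1), as a nondeterministic transition system.

module AD (m : ℕ) (A : Fin (suc m) → Fin (suc m) → Bool) (p : Fin (suc m) → Fin (suc m)) where

  V : Set
  V = Fin (suc m)

  s : V
  s = fromℕ m

  -- State of the algorithm.
  --  u    : the loop counter (0-based: vertices are numbered 0..m; the
  --         loop runs u = 0..m and the algorithm is finished when u = suc m)
  --  rep  : every ORIGINAL vertex is mapped to the current vertex it has
  --         been contracted into (rep x ≡ x iff x is still present).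
  --         An original arc (a,b) is currently the arc (rep a, rep b);
  --         this realises "replace every arc end equal to v by p(v)",
  --         keeping multiple and loop arcs that contractions create.
  --  par  : current parent function of the current spanning tree.
  --  mark : marking of the (original instances of the) arcs.
  --  same : same v w = true iff w ∈ same(v).
  --  d    : the values assigned so far to d.
  record State : Set where
    constructor st
    field
      u    : ℕ
      rep  : V → V
      par  : V → V
      mark : V → V → Bool
      same : V → V → Bool
      d    : V → Maybe V
  open State public

  initial : State
  initial = st 0 (λ x → x) p (λ _ _ → false) (λ v w → ⌊ v ≟ w ⌋) (λ _ → nothing)

  Child : State → V → V → Set
  Child σ a b = b ≢ s × rep σ b ≡ b × par σ b ≡ a

  ProperAncestor : State → V → V → Set
  ProperAncestor σ = TransClosure (Child σ)

  TreeArc : State → V → V → Set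
  TreeArc σ x w = w ≢ s × x ≡ par σ w

  ForwardArc : State → V → V → Set
  ForwardArc σ x w = w ≢ s × ProperAncestor σ x (par σ w)

  CurArc : State → V → V → V → V → Set
  CurArc σ a b x y = Arc A a b × rep σ a ≡ x × rep σ b ≡ y

  Candidate : State → V → V → V → V → Set
  Candidate σ uv v a b =
    CurArc σ a b uv v × mark σ a b ≡ false × (TreeArc σ uv v ⊎ ForwardArc σ uv v)

  AllInMarked : State → (V → V → Bool) → V → Set
  AllInMarked σ mk v = ∀ a b → Arc A a b → rep σ b ≡ v → mk a b ≡ true

  setMark : (V → V → Bool) → V → V → V → V → Bool
  setMark mk a b x y = if ⌊ x ≟ a ⌋ then (if ⌊ y ≟ b ⌋ then true else mk x y) else mk x y

  contract : State → (V → V → Bool) → V → State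
  contract σ mk v = record σ
    { rep  = λ x → if ⌊ rep σ x ≟ v ⌋ then par σ v else rep σ x
    ; par  = λ x → if ⌊ par σ x ≟ v ⌋ then par σ v else par σ x
    ; mark = mk }

  assignD : State → V → V → State
  assignD σ uv v = record σ
    { d = λ w → if same σ v w then just uv else d σ w }

  mergeSame : State → V → State
  mergeSame σ v = record σ
    { same = λ x w → if ⌊ x ≟ par σ v ⌋ then (same σ x w ∨ same σ v w) else same σ x w }

  data Step : State → State → Set where
    markOnly : ∀ σ uv v a b → toℕ uv ≡ u σ → Candidate σ uv v a b →
      ¬ AllInMarked σ (setMark (mark σ) a b) v →
      Step σ (record σ { mark = setMark (mark σ) a b })
    markTree : ∀ σ uv v a b → toℕ uv ≡ u σ → Candidate σ uv v a b →
      AllInMarked σ (setMark (mark σ) a b) v → uv ≡ par σ v →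
      Step σ (contract (assignD σ uv v) (setMark (mark σ) a b) v)
    markOther : ∀ σ uv v a b → toℕ uv ≡ u σ → Candidate σ uv v a b →
      AllInMarked σ (setMark (mark σ) a b) v → uv ≢ par σ v →
      Step σ (contract (mergeSame σ v) (setMark (mark σ) a b) v)
    advance : ∀ σ uv → toℕ uv ≡ u σ →
      ¬ (Σ V λ v → Σ V λ a → Σ V λ b → Candidate σ uv v a b) →
      Step σ (record σ { u = suc (u σ) })

module Submission where

open import Defs
open import Data.Nat using (ℕ; zero; suc; _≤_; _<_; z≤n; s≤s; _∸_; _+_)
import Data.Nat.Properties as ℕ
open import Data.Nat.Induction using (<-wellFounded)
open import Data.Fin using (Fin; fromℕ; fromℕ<; toℕ; _≟_)
import Data.Fin as Fin
open import Data.Fin.Properties using (toℕ-injective; toℕ<n; toℕ-fromℕ; toℕ-fromℕ<; ¬∀⟶∃¬; pigeonhole; all?)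
open import Data.Bool using (Bool; true; false; if_then_else_; _∨_)
open import Data.Bool.Properties using (∨-zeroʳ; ¬-not; not-¬) renaming (_≟_ to _≟ᵇ_)
open import Data.Maybe using (Maybe; just)
open import Data.Product using (Σ; _×_; _,_; proj₁; proj₂)
open import Data.Sum using (_⊎_; inj₁; inj₂; [_,_]′)
open import Data.Empty using (⊥-elim)
open import Function using (_∘′_; case_of_)
open import Relation.Nullary using (¬_; Dec; yes; no)
open import Relation.Nullary.Decidable using (⌊_⌋; _→-dec_; ¬¬-excluded-middle)
open import Relation.Binary.PropositionalEquality
  using (_≡_; _≢_; refl; sym; trans; cong; subst; subst₂; ≡-≟-identity; ≢-≟-identity)
open import Relation.Binary.Construct.Closure.Transitive as Plus using (TransClosure; [_]; _∷_; _∷ʳ_)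
open import Relation.Binary.Construct.Closure.ReflexiveTransitive using (Star; ε; _◅_)
open import Induction.WellFounded using (WellFounded; Acc; acc; module Subrelation)
open import Relation.Binary.Construct.On as On using ()
open import Data.Product.Relation.Binary.Lex.Strict using (×-Lex; ×-wellFounded)

-- Contractions keep a tree
-- structure: every vertex is contracted into a present ancestor in T, and the current parent
-- of a present vertex is its nearest present proper ancestor in T.  When the loop moves past u,
-- every vertex strictly dominated by u has been contracted away (otherwise an unmarked tree or
-- forward arc would leave u).  So when the last arc into v is marked and
-- u = p(v), every arc into v comes from a vertex contracted into u, and u = idom(v); when
-- u ≠ p(v), v and p(v) have the same strict dominators, so same(v) can join same(p(v)).
-- Hence each w ≠ s either has d(w) = idom(w), or lies in the same-set of exactly one present
-- vertex with the strict dominators of w; at the end no such vertex survives, as s dominates it.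
-- Each step marks an arc or increases u, which gives termination.

module Walks {n : ℕ} (A : Fin n → Fin n → Bool) where

  infixr 5 _++_
  _++_ : ∀ {x y z} → Path A x y → Path A y z → Path A x z
  []      ++ Q = Q
  (e ∷ P) ++ Q = e ∷ (P ++ Q)

  _∷ᵖ_ : ∀ {x y z} → Path A x y → Arc A y z → Path A x z
  P ∷ᵖ e = P ++ (e ∷ [])

  length : ∀ {x y} → Path A x y → ℕ
  length []      = 0
  length (_ ∷ P) = suc (length P)

  length-∷ᵖ : ∀ {x y z} (P : Path A x y) (e : Arc A y z) → length (P ∷ᵖ e) ≡ suc (length P)
  length-∷ᵖ []      e = refl
  length-∷ᵖ (_ ∷ P) e = cong suc (length-∷ᵖ P e)

  visits-++ : ∀ {x y z} v (P : Path A x y) (Q : Path A y z) →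
              visits v (P ++ Q) → visits v P ⊎ visits v Q
  visits-++ v []      Q h        = inj₂ h
  visits-++ v (e ∷ P) Q (inj₁ h) = inj₁ (inj₁ h)
  visits-++ v (e ∷ P) Q (inj₂ h) = [ (λ h → inj₁ (inj₂ h)) , inj₂ ]′ (visits-++ v P Q h)

  visits-source : ∀ {x y} (P : Path A x y) → visits x P
  visits-source []      = refl
  visits-source (_ ∷ _) = inj₁ refl

  visits-target : ∀ {x y} (P : Path A x y) → visits y P
  visits-target []      = refl
  visits-target (_ ∷ P) = inj₂ (visits-target P)

  _⊆ᵛ_ : ∀ {x y x′ y′} → Path A x y → Path A x′ y′ → Set
  P ⊆ᵛ Q = ∀ z → visits z P → visits z Q

  prefix : ∀ {x y} v (P : Path A x y) → visits v P → Σ (Path A x v) (_⊆ᵛ P)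
  prefix v []      refl       = [] , λ _ h → h
  prefix v (e ∷ P) (inj₁ refl) = [] , λ _ → inj₁
  prefix v (e ∷ P) (inj₂ h) with prefix v P h
  ... | Q , Q⊆P = e ∷ Q , λ { z (inj₁ h′) → inj₁ h′ ; z (inj₂ h′) → inj₂ (Q⊆P z h′) }

  unsnoc : ∀ {x y z} (e : Arc A x y) (Q : Path A y z) →
           Σ (Fin n) λ a → Σ (Path A x a) λ P → Arc A a z × P ⊆ᵛ (e ∷ Q)
  unsnoc {x} e []       = x , [] , e , λ _ → inj₁
  unsnoc     e (e′ ∷ Q) with unsnoc e′ Q
  ... | a , P , e″ , P⊆ = a , e ∷ P , e″ , λ { v (inj₁ h) → inj₁ h ; v (inj₂ h) → inj₂ (P⊆ v h) }

  path⇒star : ∀ {x y} → Path A x y → Star (Arc A) x y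
  path⇒star []      = ε
  path⇒star (e ∷ P) = e ◅ path⇒star P

  arc◅star⇒⁺ : ∀ {x y z} → Arc A x y → Star (Arc A) y z → TransClosure (Arc A) x z
  arc◅star⇒⁺ e ε        = [ e ]
  arc◅star⇒⁺ e (e′ ◅ S) = e ∷ arc◅star⇒⁺ e′ S

module Domination {n : ℕ} (A : Fin n → Fin n → Bool) (s : Fin n) where
  open Walks A

  Dom : Fin n → Fin n → Set
  Dom = Dominates A s

  StrictlyDominates : Fin n → Fin n → Set
  StrictlyDominates x y = Dom x y × x ≢ y

  SameStrictDominators : Fin n → Fin n → Set
  SameStrictDominators v w =
    (∀ y → StrictlyDominates y v → StrictlyDominates y w) ×
    (∀ y → StrictlyDominates y w → StrictlyDominates y v)

  same-strict-dominators-trans : ∀ {u v w} →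
    SameStrictDominators u v → SameStrictDominators v w → SameStrictDominators u w
  same-strict-dominators-trans (f , g) (f′ , g′) = (λ y → f′ y ∘′ f y) , (λ y → g y ∘′ g′ y)

  dom-refl : ∀ x → Dom x x
  dom-refl x = visits-target

  dom-source : ∀ x → Dom s x
  dom-source x = visits-source

  dom-trans : ∀ {x y z} → Dom x y → Dom y z → Dom x z
  dom-trans {x} {y} x⊒y y⊒z P with prefix y P (y⊒z P)
  ... | Q , Q⊆P = Q⊆P x (x⊒y Q)

  dom-pred : ∀ {x y a} → Dom x y → x ≢ y → Arc A a y → Dom x a
  dom-pred {x} x⊒y x≢y e P with visits-++ x P (e ∷ []) (x⊒y (P ∷ᵖ e))
  ... | inj₁ h        = h
  ... | inj₂ (inj₁ h) = subst (λ z → visits z P) (sym h) (visits-target P)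
  ... | inj₂ (inj₂ h) = ⊥-elim (x≢y h)

  dom-from-preds : ∀ {x y} → y ≢ s → (∀ a → Arc A a y → Dom x a) → Dom x y
  dom-from-preds y≢s x⊒preds []      = ⊥-elim (y≢s refl)
  dom-from-preds {x} y≢s x⊒preds (e ∷ Q) with unsnoc e Q
  ... | a , P , e′ , P⊆ = P⊆ x (x⊒preds a e′ P)

  idom-resp-same-strict-dominators : ∀ {i v w} →
    SameStrictDominators v w → IsIdom A s i v → IsIdom A s i w
  idom-resp-same-strict-dominators (f , g) (i⊒v , i≢v , i-least) =
    proj₁ (f _ (i⊒v , i≢v)) , proj₂ (f _ (i⊒v , i≢v)) ,
    λ z z⊒w z≢w → i-least z (proj₁ (g z (z⊒w , z≢w))) (proj₂ (g z (z⊒w , z≢w)))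

module Acyclicity {n : ℕ} (A : Fin n → Fin n → Bool) (acyclic : Acyclic A) where
  open Walks A

  vertex-at : ∀ {x y} (P : Path A x y) → Fin (suc (length P)) → Fin n
  vertex-at {x} P       Fin.zero    = x
  vertex-at     (e ∷ P) (Fin.suc i) = vertex-at P i

  reaches-vertex-at : ∀ {x y} (P : Path A x y) j → Star (Arc A) x (vertex-at P j)
  reaches-vertex-at P       Fin.zero    = ε
  reaches-vertex-at (e ∷ P) (Fin.suc j) = e ◅ reaches-vertex-at P j

  later-vertex-reachable : ∀ {x y} (P : Path A x y) (i j : Fin (suc (length P))) → toℕ i < toℕ j →
    TransClosure (Arc A) (vertex-at P i) (vertex-at P j)
  later-vertex-reachable (e ∷ P) Fin.zero    (Fin.suc j) _         = arc◅star⇒⁺ e (reaches-vertex-at P j)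
  later-vertex-reachable (e ∷ P) (Fin.suc i) (Fin.suc j) (s≤s i<j) = later-vertex-reachable P i j i<j

  length<n : ∀ {x y} (P : Path A x y) → length P < n
  length<n P with length P ℕ.<? n
  ... | yes l<n = l<n
  ... | no l≮n with pigeonhole (s≤s (ℕ.≮⇒≥ l≮n)) (vertex-at P)
  ... | i , j , i<j , same =
    ⊥-elim (acyclic _ (subst (TransClosure (Arc A) (vertex-at P i)) (sym same) (later-vertex-reachable P i j i<j)))

  private
    acc-arcs : ∀ k x → (∀ y (P : Path A y x) → length P < k) → Acc (Arc A) x
    acc-arcs zero    x bound = ⊥-elim (ℕ.n≮0 (bound x []))
    acc-arcs (suc k) x bound = acc λ {a} e → acc-arcs k a λ y P →
      ℕ.≤-pred (subst (_< suc k) (length-∷ᵖ P e) (bound y (P ∷ᵖ e)))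

  arcs-wellFounded : WellFounded (Arc A)
  arcs-wellFounded x = acc-arcs n x λ _ → length<n

  reachability-wellFounded : WellFounded (TransClosure (Arc A))
  reachability-wellFounded = Plus.wellFounded (Arc A) arcs-wellFounded

module SpanningTree (m : ℕ) (A : Fin (suc m) → Fin (suc m) → Bool) (p : Fin (suc m) → Fin (suc m))
                    (tree : IsBottomUpSpanningTree m A p) where
  open Walks A
  open Domination A (fromℕ m)

  V : Set
  V = Fin (suc m)

  s : V
  s = fromℕ m

  parent-arc : ∀ y → y ≢ s → Arc A (p y) y
  parent-arc y y≢s = proj₁ (tree y y≢s)

  parent-> : ∀ y → y ≢ s → toℕ y < toℕ (p y)
  parent-> y y≢s = proj₂ (tree y y≢s)

  data Ancestor : V → V → Set where
    here : ∀ {x} → Ancestor x x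
    up   : ∀ {x y} → y ≢ s → Ancestor x (p y) → Ancestor x y

  StrictAncestor : V → V → Set
  StrictAncestor x y = y ≢ s × Ancestor x (p y)

  ancestor-≥ : ∀ {x y} → Ancestor x y → toℕ y ≤ toℕ x
  ancestor-≥ here          = ℕ.≤-refl
  ancestor-≥ (up y≢s x≥py) = ℕ.<⇒≤ (ℕ.<-≤-trans (parent-> _ y≢s) (ancestor-≥ x≥py))

  strict-ancestor-> : ∀ {x y} → StrictAncestor x y → toℕ y < toℕ x
  strict-ancestor-> (y≢s , x≥py) = ℕ.<-≤-trans (parent-> _ y≢s) (ancestor-≥ x≥py)

  strict-ancestor-≢ : ∀ {x y} → StrictAncestor x y → x ≢ y
  strict-ancestor-≢ x>y refl = ℕ.<-irrefl refl (strict-ancestor-> x>y)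

  strict⇒ancestor : ∀ {x y} → StrictAncestor x y → Ancestor x y
  strict⇒ancestor (y≢s , x≥py) = up y≢s x≥py

  ancestor⇒strict : ∀ {x y} → Ancestor x y → x ≢ y → StrictAncestor x y
  ancestor⇒strict here          x≢x = ⊥-elim (x≢x refl)
  ancestor⇒strict (up y≢s x≥py) _   = y≢s , x≥py

  ancestor-≤⇒≡ : ∀ {x y} → Ancestor x y → toℕ x ≤ toℕ y → x ≡ y
  ancestor-≤⇒≡ x≥y x≤y = toℕ-injective (ℕ.≤-antisym x≤y (ancestor-≥ x≥y))

  ancestor-antisym : ∀ {x y} → Ancestor x y → Ancestor y x → x ≡ y
  ancestor-antisym x≥y y≥x = ancestor-≤⇒≡ x≥y (ancestor-≥ y≥x)

  ancestor-trans : ∀ {x y z} → Ancestor x y → Ancestor y z → Ancestor x z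
  ancestor-trans x≥y here          = x≥y
  ancestor-trans x≥y (up z≢s y≥pz) = up z≢s (ancestor-trans x≥y y≥pz)

  strict-ancestor-trans : ∀ {x y z} → StrictAncestor x y → StrictAncestor y z → StrictAncestor x z
  strict-ancestor-trans x>y (z≢s , y≥pz) = z≢s , ancestor-trans (strict⇒ancestor x>y) y≥pz

  ancestors-comparable : ∀ {x y z} → Ancestor x z → Ancestor y z → Ancestor x y ⊎ Ancestor y x
  ancestors-comparable here         y≥x          = inj₂ y≥x
  ancestors-comparable (up z≢s x≥pz) here        = inj₁ (up z≢s x≥pz)
  ancestors-comparable (up _ x≥pz)  (up _ y≥pz)  = ancestors-comparable x≥pz y≥pz

  -- The fuel k bounds the number of parent steps still needed to reach s.
  private
    root-ancestor-within : ∀ k y → m ≤ toℕ y + k → Ancestor s y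
    root-ancestor-within k y m≤y+k with y ≟ s
    ... | yes refl = here
    root-ancestor-within zero    y m≤y | no y≢s =
      ⊥-elim (y≢s (toℕ-injective (trans (ℕ.≤-antisym (ℕ.≤-pred (toℕ<n y)) (subst (m ≤_) (ℕ.+-identityʳ (toℕ y)) m≤y))
                                        (sym (toℕ-fromℕ m)))))
    root-ancestor-within (suc k) y m≤y+k | no y≢s =
      up y≢s (root-ancestor-within k (p y) (ℕ.≤-trans m≤y+k
        (subst (_≤ toℕ (p y) + k) (sym (ℕ.+-suc (toℕ y) k)) (ℕ.+-monoˡ-≤ k (parent-> y y≢s)))))

  root-ancestor : ∀ y → Ancestor s y
  root-ancestor y = root-ancestor-within m y (ℕ.m≤n+m m (toℕ y))

  tree-path : ∀ {x y} → Ancestor x y → Path A x y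
  tree-path here          = []
  tree-path (up y≢s x≥py) = tree-path x≥py ∷ᵖ parent-arc _ y≢s

  tree-path-visits : ∀ {x y} z (x≥y : Ancestor x y) → visits z (tree-path x≥y) → Ancestor x z × Ancestor z y
  tree-path-visits z here refl = here , here
  tree-path-visits z (up y≢s x≥py) h with visits-++ z (tree-path x≥py) (parent-arc _ y≢s ∷ []) h
  ... | inj₁ h′         = proj₁ (tree-path-visits z x≥py h′) ,
                          ancestor-trans (proj₂ (tree-path-visits z x≥py h′)) (up y≢s here)
  ... | inj₂ (inj₁ refl) = x≥py , up y≢s here
  ... | inj₂ (inj₂ refl) = up y≢s x≥py , here

  dominator⇒ancestor : ∀ {x y} → Dom x y → Ancestor x y
  dominator⇒ancestor {x} {y} x⊒y =
    proj₂ (tree-path-visits x (root-ancestor y) (x⊒y (tree-path (root-ancestor y))))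

  -- A path to t continues down the tree to y, and x can only lie on that tree part if it is above t.
  dom-lift : ∀ {t x y} → Ancestor t y → Dom x y → ¬ Ancestor t x → Dom x t
  dom-lift {t} {x} t≥y x⊒y t≱x P with visits-++ x P (tree-path t≥y) (x⊒y (P ++ tree-path t≥y))
  ... | inj₁ h = h
  ... | inj₂ h = ⊥-elim (t≱x (proj₁ (tree-path-visits x t≥y h)))

module _ {k : ℕ} where

  ⌊≟⌋-refl : (x : Fin k) → ⌊ x ≟ x ⌋ ≡ true
  ⌊≟⌋-refl x rewrite ≡-≟-identity _≟_ (refl {x = x}) = refl

  ⌊≟⌋-≢ : {x y : Fin k} → x ≢ y → ⌊ x ≟ y ⌋ ≡ false
  ⌊≟⌋-≢ x≢y rewrite ≢-≟-identity _≟_ x≢y = refl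

  ⌊≟⌋⇒≡ : {x y : Fin k} → ⌊ x ≟ y ⌋ ≡ true → x ≡ y
  ⌊≟⌋⇒≡ {x} {y} h with x ≟ y
  ... | yes x≡y = x≡y

  if-≟-yes : {B : Set} {x v : Fin k} {a b : B} → x ≡ v → (if ⌊ x ≟ v ⌋ then a else b) ≡ a
  if-≟-yes x≡v rewrite ≡-≟-identity _≟_ x≡v = refl

  if-≟-no : {B : Set} {x v : Fin k} {a b : B} → x ≢ v → (if ⌊ x ≟ v ⌋ then a else b) ≡ b
  if-≟-no x≢v rewrite ≢-≟-identity _≟_ x≢v = refl

  if-≟-cases : {B : Set} (x v : Fin k) (a b : B) →
    (x ≡ v × (if ⌊ x ≟ v ⌋ then a else b) ≡ a) ⊎ (x ≢ v × (if ⌊ x ≟ v ⌋ then a else b) ≡ b)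
  if-≟-cases x v a b with x ≟ v
  ... | yes x≡v = inj₁ (x≡v , refl)
  ... | no  x≢v = inj₂ (x≢v , refl)

∨≡true⁻ : ∀ x {y} → (x ∨ y) ≡ true → x ≡ true ⊎ y ≡ true
∨≡true⁻ true  _ = inj₁ refl
∨≡true⁻ false h = inj₂ h

∑ : ∀ {k} → (Fin k → ℕ) → ℕ
∑ {zero}  f = 0
∑ {suc k} f = f Fin.zero + ∑ (λ i → f (Fin.suc i))

∑-mono-≤ : ∀ {k} {f g : Fin k → ℕ} → (∀ i → f i ≤ g i) → ∑ f ≤ ∑ g
∑-mono-≤ {zero}  f≤g = z≤n
∑-mono-≤ {suc k} f≤g = ℕ.+-mono-≤ (f≤g Fin.zero) (∑-mono-≤ (λ i → f≤g (Fin.suc i)))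

∑-mono-< : ∀ {k} {f g : Fin k → ℕ} → (∀ i → f i ≤ g i) → ∀ j → f j < g j → ∑ f < ∑ g
∑-mono-< {suc k} f≤g Fin.zero    fj<gj = ℕ.+-mono-<-≤ fj<gj (∑-mono-≤ (λ i → f≤g (Fin.suc i)))
∑-mono-< {suc k} f≤g (Fin.suc j) fj<gj = ℕ.+-mono-≤-< (f≤g Fin.zero) (∑-mono-< (λ i → f≤g (Fin.suc i)) j fj<gj)

module Correctness (m : ℕ) (A : Fin (suc m) → Fin (suc m) → Bool) (p : Fin (suc m) → Fin (suc m))
                   (acyclic : Acyclic A) (tree : IsBottomUpSpanningTree m A p) where
  open Walks A
  open Domination A (fromℕ m)
  open Acyclicity A acyclic
  open SpanningTree m A p tree
  open AD m A p hiding (V; s)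

  Present : State → V → Set
  Present σ x = rep σ x ≡ x

  record Assigned (rep : V → V) (same : V → V → Bool) (d : V → Maybe V) (w : V) : Set where
    field
      idom       : V
      d≡idom     : d w ≡ just idom
      is-idom    : IsIdom A s idom w
      in-no-same : ∀ v → rep v ≡ v → same v w ≡ false

  record Pending (rep : V → V) (same : V → V → Bool) (w : V) : Set where
    field
      owner           : V
      owner-present   : rep owner ≡ owner
      owner≢s         : owner ≢ s
      in-owner-same   : same owner w ≡ true
      owner-same-sdom : SameStrictDominators owner w
      owner-unique    : ∀ v → rep v ≡ v → same v w ≡ true → v ≡ owner

  -- A vertex is processed once its number is below u.
  record Invariant (σ : State) : Set where
    field
      u≤n                        : u σ ≤ suc m
      root-present               : Present σ s
      rep-present                : ∀ x → Present σ (rep σ x)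
      rep-ancestor               : ∀ x → Ancestor (rep σ x) x
      par-present                : ∀ b → Present σ b → b ≢ s → Present σ (par σ b)
      par-strict-ancestor        : ∀ b → Present σ b → b ≢ s → StrictAncestor (par σ b) b
      par-nearest                : ∀ b c → Present σ b → b ≢ s → Present σ c →
                                   StrictAncestor c b → Ancestor c (par σ b)
      absorbed-processed         : ∀ x → Present σ x ⊎ toℕ (rep σ x) ≤ u σ
      unprocessed-present        : ∀ x → u σ ≤ toℕ x → Present σ x
      unmarked-in-arc            : ∀ v → Present σ v → v ≢ s → Σ V λ a → Arc A a v × mark σ a v ≡ false
      unmarked-target-present    : ∀ a b → Arc A a b → mark σ a b ≡ false → Present σ b
      marked-arc-ancestor        : ∀ a b → Arc A a b → mark σ a b ≡ true → Ancestor (rep σ a) (rep σ b)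
      marked-arc-processed       : ∀ a b → Arc A a b → mark σ a b ≡ true → toℕ (rep σ a) ≤ u σ
      processed-dominated-absent : ∀ D x → toℕ D < u σ → StrictlyDominates D x → ¬ Present σ x
      dom-rep⇒dom                : ∀ a x → StrictlyDominates x (rep σ a) → Dom x a
      unprocessed-rep-dominates  : ∀ a → u σ ≤ toℕ (rep σ a) → Dom (rep σ a) a
      root-same-empty            : ∀ w → w ≢ s → same σ s w ≡ false
      resolved                   : ∀ w → w ≢ s → Assigned (rep σ) (same σ) (d σ) w ⊎ Pending (rep σ) (same σ) w

  initial-invariant : Invariant initial
  initial-invariant = record
    { u≤n                        = z≤n
    ; root-present               = refl
    ; rep-present                = λ _ → refl
    ; rep-ancestor               = λ _ → here
    ; par-present                = λ _ _ _ → refl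
    ; par-strict-ancestor        = λ _ _ b≢s → b≢s , here
    ; par-nearest                = λ _ _ _ _ _ c>b → proj₂ c>b
    ; absorbed-processed         = λ _ → inj₁ refl
    ; unprocessed-present        = λ _ _ → refl
    ; unmarked-in-arc            = λ v _ v≢s → p v , parent-arc v v≢s , refl
    ; unmarked-target-present    = λ _ _ _ _ → refl
    ; marked-arc-ancestor        = λ _ _ _ ()
    ; marked-arc-processed       = λ _ _ _ ()
    ; processed-dominated-absent = λ _ _ ()
    ; dom-rep⇒dom                = λ _ _ x⊐a → proj₁ x⊐a
    ; unprocessed-rep-dominates  = λ a _ → dom-refl a
    ; root-same-empty            = λ w w≢s → ⌊≟⌋-≢ (λ s≡w → w≢s (sym s≡w))
    ; resolved                   = λ w w≢s → inj₂ (record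
        { owner           = w
        ; owner-present   = refl
        ; owner≢s         = w≢s
        ; in-owner-same   = ⌊≟⌋-refl w
        ; owner-same-sdom = (λ _ h → h) , (λ _ h → h)
        ; owner-unique    = λ _ _ → ⌊≟⌋⇒≡ })
    }

  setMark-true : ∀ mk a b x y → setMark mk a b x y ≡ true → (x ≡ a × y ≡ b) ⊎ mk x y ≡ true
  setMark-true mk a b x y h with x ≟ a | y ≟ b
  ... | yes x≡a | yes y≡b = inj₁ (x≡a , y≡b)
  ... | yes _   | no _    = inj₂ h
  ... | no _    | _       = inj₂ h

  setMark-other : ∀ mk a b x y → y ≢ b → setMark mk a b x y ≡ mk x y
  setMark-other mk a b x y y≢b with x ≟ a | y ≟ b
  ... | yes _ | yes y≡b = ⊥-elim (y≢b y≡b)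
  ... | yes _ | no _    = refl
  ... | no _  | _       = refl

  setMark-false : ∀ mk a b x y → setMark mk a b x y ≡ false → mk x y ≡ false
  setMark-false mk a b x y h with x ≟ a | y ≟ b
  setMark-false mk a b x y () | yes _ | yes _
  ... | yes _ | no _ = h
  ... | no _  | _    = h

  setMark-hit : ∀ mk a b → setMark mk a b a b ≡ true
  setMark-hit mk a b rewrite ⌊≟⌋-refl a | ⌊≟⌋-refl b = refl

  private
    counterexample : ∀ {P Q : Set} (r : Bool) → Dec P → Dec Q → ¬ (P → Q → r ≡ true) → P × Q × r ≡ false
    counterexample true  _       _       ¬imp = ⊥-elim (¬imp (λ _ _ → refl))
    counterexample false (yes x) (yes y) _    = x , y , refl
    counterexample false (no ¬x) _       ¬imp = ⊥-elim (¬imp (λ x _ → ⊥-elim (¬x x)))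
    counterexample false (yes _) (no ¬y) ¬imp = ⊥-elim (¬imp (λ _ y → ⊥-elim (¬y y)))

    marked? : ∀ σ (mk : V → V → Bool) v a b → Dec (Arc A a b → rep σ b ≡ v → mk a b ≡ true)
    marked? σ mk v a b = (A a b ≟ᵇ true) →-dec ((rep σ b ≟ v) →-dec (mk a b ≟ᵇ true))

  unmarked-arc-into : ∀ σ mk v → ¬ AllInMarked σ mk v →
    Σ V λ a → Σ V λ b → Arc A a b × rep σ b ≡ v × mk a b ≡ false
  unmarked-arc-into σ mk v ¬all with ¬∀⟶∃¬ _ _ (λ a → all? (marked? σ mk v a)) ¬all
  ... | a , ¬all-a with ¬∀⟶∃¬ _ _ (marked? σ mk v a) ¬all-a
  ... | b , ¬ab = a , b , counterexample (mk a b) (A a b ≟ᵇ true) (rep σ b ≟ v) ¬ab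

  record CandidateFacts (σ : State) (uv v a b : V) : Set where
    field
      b≡v             : b ≡ v
      v-present       : Present σ v
      v≢s             : v ≢ s
      rep-a≡u         : rep σ a ≡ uv
      rep-a-processed : toℕ (rep σ a) ≤ u σ
      rep-a≥rep-b     : Ancestor (rep σ a) (rep σ b)
      u-present       : Present σ uv
      u>v             : StrictAncestor uv v
      pv-present      : Present σ (par σ v)
      pv>v            : StrictAncestor (par σ v) v
      u≡pv⊎u>pv       : uv ≡ par σ v ⊎ StrictAncestor uv (par σ v)
      pv-processed    : toℕ (par σ v) ≤ u σ

  module Preservation {σ : State} (I : Invariant σ) where
    open Invariant I

    current⇒strict-ancestor : ∀ {x y} → ProperAncestor σ x y → StrictAncestor x y
    current⇒strict-ancestor [ y≢s , y-present , refl ] = par-strict-ancestor _ y-present y≢s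
    current⇒strict-ancestor ((y≢s , y-present , refl) ∷ rest) =
      strict-ancestor-trans (par-strict-ancestor _ y-present y≢s) (current⇒strict-ancestor rest)

    strict-dominator-unprocessed : ∀ x y → Present σ y → StrictlyDominates x y → u σ ≤ toℕ x
    strict-dominator-unprocessed x y y-present x⊐y =
      ℕ.≮⇒≥ (λ x<u → processed-dominated-absent x y x<u x⊐y y-present)

    candidate-facts : ∀ {uv v a b} → toℕ uv ≡ u σ → Candidate σ uv v a b → CandidateFacts σ uv v a b
    candidate-facts {uv} {v} {a} {b} u≡ ((arc , rep-a , rep-b) , unmarked , tree⊎forward) = record
      { b≡v             = b≡v
      ; v-present       = v-present
      ; v≢s             = v≢s
      ; rep-a≡u         = rep-a
      ; rep-a-processed = ℕ.≤-reflexive (trans (cong toℕ rep-a) u≡)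
      ; rep-a≥rep-b     = subst₂ Ancestor (sym rep-a) (sym rep-b) (strict⇒ancestor u>v)
      ; u-present       = unprocessed-present uv (ℕ.≤-reflexive (sym u≡))
      ; u>v             = u>v
      ; pv-present      = par-present v v-present v≢s
      ; pv>v            = pv>v
      ; u≡pv⊎u>pv       = u≡pv⊎u>pv
      ; pv-processed    = [ (λ u≡pv → ℕ.≤-reflexive (trans (cong toℕ (sym u≡pv)) u≡))
                          , (λ u>pv → ℕ.<⇒≤ (subst (toℕ (par σ v) <_) u≡ (strict-ancestor-> u>pv))) ]′ u≡pv⊎u>pv
      }
      where
      b-present : Present σ b
      b-present = unmarked-target-present a b arc unmarked
      b≡v : b ≡ v
      b≡v = trans (sym b-present) rep-b
      v-present : Present σ v
      v-present = subst (Present σ) b≡v b-present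
      v≢s : v ≢ s
      v≢s = [ proj₁ , proj₁ ]′ tree⊎forward
      pv>v : StrictAncestor (par σ v) v
      pv>v = par-strict-ancestor v v-present v≢s
      u≡pv⊎u>pv : uv ≡ par σ v ⊎ StrictAncestor uv (par σ v)
      u≡pv⊎u>pv = [ (λ t → inj₁ (proj₂ t)) , (λ f → inj₂ (current⇒strict-ancestor (proj₂ f))) ]′ tree⊎forward
      u>v : StrictAncestor uv v
      u>v = [ (λ u≡pv → subst (λ z → StrictAncestor z v) (sym u≡pv) pv>v)
            , (λ u>pv → strict-ancestor-trans u>pv pv>v) ]′ u≡pv⊎u>pv

    mark-only-preserves : ∀ {uv v a b} → toℕ uv ≡ u σ → Candidate σ uv v a b →
      ¬ AllInMarked σ (setMark (mark σ) a b) v → Invariant (record σ { mark = setMark (mark σ) a b })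
    mark-only-preserves {uv} {v} {a} {b} u≡ cand ¬all = record
      { u≤n = u≤n ; root-present = root-present ; rep-present = rep-present ; rep-ancestor = rep-ancestor
      ; par-present = par-present ; par-strict-ancestor = par-strict-ancestor ; par-nearest = par-nearest
      ; absorbed-processed = absorbed-processed ; unprocessed-present = unprocessed-present
      ; unmarked-in-arc = unmarked-in-arc′
      ; unmarked-target-present = λ a′ b′ arc unmarked →
          unmarked-target-present a′ b′ arc (setMark-false (mark σ) a b a′ b′ unmarked)
      ; marked-arc-ancestor = marked-arc-ancestor′ ; marked-arc-processed = marked-arc-processed′
      ; processed-dominated-absent = processed-dominated-absent ; dom-rep⇒dom = dom-rep⇒dom
      ; unprocessed-rep-dominates = unprocessed-rep-dominates
      ; root-same-empty = root-same-empty ; resolved = resolved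
      }
      where
      open CandidateFacts (candidate-facts u≡ cand)
      mk′ : V → V → Bool
      mk′ = setMark (mark σ) a b

      unmarked-in-arc′ : ∀ v′ → Present σ v′ → v′ ≢ s → Σ V λ a′ → Arc A a′ v′ × mk′ a′ v′ ≡ false
      unmarked-in-arc′ v′ v′-present v′≢s with v′ ≟ v
      ... | yes refl with unmarked-arc-into σ mk′ v ¬all
      ... | a′ , b′ , arc , rep-b′ , unmarked =
        a′ , subst (Arc A a′) b′≡v arc , subst (λ z → mk′ a′ z ≡ false) b′≡v unmarked
        where
        b′≡v : b′ ≡ v
        b′≡v = trans (sym (unmarked-target-present a′ b′ arc (setMark-false (mark σ) a b a′ b′ unmarked))) rep-b′
      unmarked-in-arc′ v′ v′-present v′≢s | no v′≢v with unmarked-in-arc v′ v′-present v′≢s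
      ... | a′ , arc , unmarked =
        a′ , arc , trans (setMark-other (mark σ) a b a′ v′ (λ v′≡b → v′≢v (trans v′≡b b≡v))) unmarked

      marked-arc-ancestor′ : ∀ a′ b′ → Arc A a′ b′ → mk′ a′ b′ ≡ true → Ancestor (rep σ a′) (rep σ b′)
      marked-arc-ancestor′ a′ b′ arc marked with setMark-true (mark σ) a b a′ b′ marked
      ... | inj₁ (refl , refl) = rep-a≥rep-b
      ... | inj₂ marked-before = marked-arc-ancestor a′ b′ arc marked-before

      marked-arc-processed′ : ∀ a′ b′ → Arc A a′ b′ → mk′ a′ b′ ≡ true → toℕ (rep σ a′) ≤ u σ
      marked-arc-processed′ a′ b′ arc marked with setMark-true (mark σ) a b a′ b′ marked
      ... | inj₁ (refl , refl) = rep-a-processed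
      ... | inj₂ marked-before = marked-arc-processed a′ b′ arc marked-before

    module Contraction {uv v a b : V} (u≡ : toℕ uv ≡ u σ) (cand : Candidate σ uv v a b)
                       (all-marked : AllInMarked σ (setMark (mark σ) a b) v) where
      open CandidateFacts (candidate-facts u≡ cand)

      pv : V
      pv = par σ v

      mk′ : V → V → Bool
      mk′ = setMark (mark σ) a b

      rep′ : V → V
      rep′ x = if ⌊ rep σ x ≟ v ⌋ then pv else rep σ x

      par′ : V → V
      par′ x = if ⌊ par σ x ≟ v ⌋ then pv else par σ x

      pv≢v : pv ≢ v
      pv≢v = strict-ancestor-≢ pv>v

      v<u : toℕ v < u σ
      v<u = subst (toℕ v <_) u≡ (strict-ancestor-> u>v)

      rep′-cases : ∀ x → (rep σ x ≡ v × rep′ x ≡ pv) ⊎ (rep σ x ≢ v × rep′ x ≡ rep σ x)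
      rep′-cases x = if-≟-cases (rep σ x) v pv (rep σ x)

      par′-cases : ∀ x → (par σ x ≡ v × par′ x ≡ pv) ⊎ (par σ x ≢ v × par′ x ≡ par σ x)
      par′-cases x = if-≟-cases (par σ x) v pv (par σ x)

      present′⇒present : ∀ x → rep′ x ≡ x → Present σ x × x ≢ v
      present′⇒present x present′ with rep′-cases x
      ... | inj₁ (rx≡v , rx′≡pv) =
        ⊥-elim (pv≢v (sym (trans (sym rx≡v) (trans (cong (rep σ) (trans (sym present′) rx′≡pv)) pv-present))))
      ... | inj₂ (rx≢v , rx′≡rx) =
        trans (sym rx′≡rx) present′ , λ x≡v → rx≢v (trans (trans (sym rx′≡rx) present′) x≡v)

      present⇒present′ : ∀ x → Present σ x → x ≢ v → rep′ x ≡ x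
      present⇒present′ x x-present x≢v = trans (if-≟-no (λ rx≡v → x≢v (trans (sym x-present) rx≡v))) x-present

      root-present′ : rep′ s ≡ s
      root-present′ = present⇒present′ s root-present (λ s≡v → v≢s (sym s≡v))

      rep-present′ : ∀ x → rep′ (rep′ x) ≡ rep′ x
      rep-present′ x with rep′-cases x
      ... | inj₁ (_ , e)    rewrite e = present⇒present′ pv pv-present pv≢v
      ... | inj₂ (rx≢v , e) rewrite e = present⇒present′ (rep σ x) (rep-present x) rx≢v

      rep-ancestor′ : ∀ x → Ancestor (rep′ x) x
      rep-ancestor′ x with rep′-cases x
      ... | inj₁ (rx≡v , e) rewrite e =
        ancestor-trans (strict⇒ancestor pv>v) (subst (λ z → Ancestor z x) rx≡v (rep-ancestor x))
      ... | inj₂ (_ , e)    rewrite e = rep-ancestor x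

      par-present′ : ∀ b′ → rep′ b′ ≡ b′ → b′ ≢ s → rep′ (par′ b′) ≡ par′ b′
      par-present′ b′ present′ b′≢s with present′⇒present b′ present′ | par′-cases b′
      ... | _         , _ | inj₁ (_ , e)     rewrite e = present⇒present′ pv pv-present pv≢v
      ... | b-present , _ | inj₂ (pb≢v , e) rewrite e =
        present⇒present′ (par σ b′) (par-present b′ b-present b′≢s) pb≢v

      par-strict-ancestor′ : ∀ b′ → rep′ b′ ≡ b′ → b′ ≢ s → StrictAncestor (par′ b′) b′
      par-strict-ancestor′ b′ present′ b′≢s with present′⇒present b′ present′ | par′-cases b′
      ... | b-present , _ | inj₁ (pb≡v , e) rewrite e =
        strict-ancestor-trans pv>v (subst (λ z → StrictAncestor z b′) pb≡v (par-strict-ancestor b′ b-present b′≢s))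
      ... | b-present , _ | inj₂ (_ , e)    rewrite e = par-strict-ancestor b′ b-present b′≢s

      par-nearest′ : ∀ b′ c → rep′ b′ ≡ b′ → b′ ≢ s → rep′ c ≡ c → StrictAncestor c b′ → Ancestor c (par′ b′)
      par-nearest′ b′ c b-present′ b′≢s c-present′ c>b
        with present′⇒present b′ b-present′ | present′⇒present c c-present′ | par′-cases b′
      ... | b-present , _ | c-present , c≢v | inj₁ (pb≡v , e) rewrite e =
        par-nearest v c v-present v≢s c-present
          (ancestor⇒strict (subst (Ancestor c) pb≡v (par-nearest b′ c b-present b′≢s c-present c>b)) c≢v)
      ... | b-present , _ | c-present , _   | inj₂ (_ , e)    rewrite e =
        par-nearest b′ c b-present b′≢s c-present c>b

      processed-rep′ : ∀ x → toℕ (rep σ x) ≤ u σ → toℕ (rep′ x) ≤ u σ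
      processed-rep′ x rx≤u with rep′-cases x
      ... | inj₁ (_ , e) rewrite e = pv-processed
      ... | inj₂ (_ , e) rewrite e = rx≤u

      absorbed-processed′ : ∀ x → rep′ x ≡ x ⊎ toℕ (rep′ x) ≤ u σ
      absorbed-processed′ x with rep′-cases x
      ... | inj₁ (_ , e) rewrite e = inj₂ pv-processed
      ... | inj₂ (_ , e) rewrite e = absorbed-processed x

      unprocessed-present′ : ∀ x → u σ ≤ toℕ x → rep′ x ≡ x
      unprocessed-present′ x u≤x = present⇒present′ x (unprocessed-present x u≤x)
        (λ x≡v → ℕ.<-irrefl refl (ℕ.<-≤-trans (subst (λ z → toℕ z < u σ) (sym x≡v) v<u) u≤x))

      unmarked-in-arc′ : ∀ v′ → rep′ v′ ≡ v′ → v′ ≢ s → Σ V λ a′ → Arc A a′ v′ × mk′ a′ v′ ≡ false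
      unmarked-in-arc′ v′ present′ v′≢s with present′⇒present v′ present′
      ... | v′-present , v′≢v with unmarked-in-arc v′ v′-present v′≢s
      ... | a′ , arc , unmarked =
        a′ , arc , trans (setMark-other (mark σ) a b a′ v′ (λ v′≡b → v′≢v (trans v′≡b b≡v))) unmarked

      unmarked-target-present′ : ∀ a′ b′ → Arc A a′ b′ → mk′ a′ b′ ≡ false → rep′ b′ ≡ b′
      unmarked-target-present′ a′ b′ arc unmarked = present⇒present′ b′ b′-present b′≢v
        where
        b′-present : Present σ b′
        b′-present = unmarked-target-present a′ b′ arc (setMark-false (mark σ) a b a′ b′ unmarked)
        b′≢v : b′ ≢ v
        b′≢v b′≡v = not-¬ unmarked (all-marked a′ b′ arc (trans b′-present b′≡v))

      ancestor-rep′ : ∀ x y → Ancestor (rep σ x) (rep σ y) → Ancestor (rep′ x) (rep′ y)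
      ancestor-rep′ x y rx≥ry with rep′-cases x | rep′-cases y
      ... | inj₁ (_ , ex)     | inj₁ (_ , ey)     rewrite ex | ey = here
      ... | inj₂ (rx≢v , ex)  | inj₁ (ry≡v , ey)  rewrite ex | ey =
        par-nearest v (rep σ x) v-present v≢s (rep-present x)
          (ancestor⇒strict (subst (Ancestor (rep σ x)) ry≡v rx≥ry) rx≢v)
      ... | inj₁ (rx≡v , ex)  | inj₂ (_ , ey)     rewrite ex | ey =
        ancestor-trans (strict⇒ancestor pv>v) (subst (λ z → Ancestor z (rep σ y)) rx≡v rx≥ry)
      ... | inj₂ (_ , ex)     | inj₂ (_ , ey)     rewrite ex | ey = rx≥ry

      marked-arc-ancestor′ : ∀ a′ b′ → Arc A a′ b′ → mk′ a′ b′ ≡ true → Ancestor (rep′ a′) (rep′ b′)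
      marked-arc-ancestor′ a′ b′ arc marked with setMark-true (mark σ) a b a′ b′ marked
      ... | inj₁ (refl , refl) = ancestor-rep′ a b rep-a≥rep-b
      ... | inj₂ marked-before = ancestor-rep′ a′ b′ (marked-arc-ancestor a′ b′ arc marked-before)

      marked-arc-processed′ : ∀ a′ b′ → Arc A a′ b′ → mk′ a′ b′ ≡ true → toℕ (rep′ a′) ≤ u σ
      marked-arc-processed′ a′ b′ arc marked with setMark-true (mark σ) a b a′ b′ marked
      ... | inj₁ (refl , refl) = processed-rep′ a rep-a-processed
      ... | inj₂ marked-before = processed-rep′ a′ (marked-arc-processed a′ b′ arc marked-before)

      processed-dominated-absent′ : ∀ D x → toℕ D < u σ → StrictlyDominates D x → rep′ x ≢ x
      processed-dominated-absent′ D x D<u D⊐x present′ =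
        processed-dominated-absent D x D<u D⊐x (proj₁ (present′⇒present x present′))

      dom-rep⇒dom′ : (∀ x → StrictlyDominates x pv → StrictlyDominates x v) →
                     ∀ a′ x → StrictlyDominates x (rep′ a′) → Dom x a′
      dom-rep⇒dom′ pv⊏⇒v⊏ a′ x x⊐ra′ with rep′-cases a′
      ... | inj₁ (ra≡v , e) rewrite e =
        dom-rep⇒dom a′ x (subst (StrictlyDominates x) (sym ra≡v) (pv⊏⇒v⊏ x x⊐ra′))
      ... | inj₂ (_ , e)    rewrite e = dom-rep⇒dom a′ x x⊐ra′

      unprocessed-rep-dominates′ : (u σ ≤ toℕ pv → StrictlyDominates pv v) →
                                   ∀ a′ → u σ ≤ toℕ (rep′ a′) → Dom (rep′ a′) a′
      unprocessed-rep-dominates′ pv⊐v a′ u≤ra′ with rep′-cases a′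
      ... | inj₁ (ra≡v , e) rewrite e =
        dom-rep⇒dom a′ pv (subst (StrictlyDominates pv) (sym ra≡v) (pv⊐v u≤ra′))
      ... | inj₂ (_ , e)    rewrite e = unprocessed-rep-dominates a′ u≤ra′

      in-arc-source : ∀ a′ → Arc A a′ v →
        Present σ (rep σ a′) × StrictAncestor (rep σ a′) v × toℕ (rep σ a′) ≤ u σ
      in-arc-source a′ arc with setMark-true (mark σ) a b a′ v (all-marked a′ v arc v-present)
      ... | inj₁ (refl , _) =
        subst (Present σ) (sym rep-a≡u) u-present , subst (λ z → StrictAncestor z v) (sym rep-a≡u) u>v , rep-a-processed
      ... | inj₂ marked = rep-present a′ , ancestor⇒strict ra≥v ra≢v , marked-arc-processed a′ v arc marked
        where
        ra≥v : Ancestor (rep σ a′) v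
        ra≥v = subst (Ancestor (rep σ a′)) v-present (marked-arc-ancestor a′ v arc marked)
        ra≢v : rep σ a′ ≢ v
        ra≢v ra≡v = acyclic a′
          (arc◅star⇒⁺ arc (path⇒star (tree-path (subst (λ z → Ancestor z a′) ra≡v (rep-ancestor a′)))))

      in-arc-source≥pv : ∀ a′ → Arc A a′ v → Ancestor (rep σ a′) pv
      in-arc-source≥pv a′ arc with in-arc-source a′ arc
      ... | ra-present , ra>v , _ = par-nearest v (rep σ a′) v-present v≢s ra-present ra>v

      ¬unprocessed≤processed : ∀ {t x} → toℕ t ≤ u σ → u σ ≤ toℕ x → x ≢ t → ¬ Ancestor t x
      ¬unprocessed≤processed t≤u u≤x x≢t t≥x = x≢t (sym (ancestor-≤⇒≡ t≥x (ℕ.≤-trans t≤u u≤x)))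

      -- Each arc into v starts in a vertex contracted into an ancestor of u = p(v) that is processed,
      -- hence into u itself; and u dominates whatever has been contracted into it.
      module TreeCase (u≡pv : uv ≡ pv) where
        u⊒v : Dom uv v
        u⊒v = dom-from-preds v≢s λ a′ arc →
          let ra≡u = ancestor-≤⇒≡ (subst (Ancestor (rep σ a′)) (sym u≡pv) (in-arc-source≥pv a′ arc))
                                  (ℕ.≤-trans (proj₂ (proj₂ (in-arc-source a′ arc))) (ℕ.≤-reflexive (sym u≡)))
          in subst (λ z → Dom z a′) ra≡u
               (unprocessed-rep-dominates a′ (subst (λ z → u σ ≤ toℕ z) (sym ra≡u) (ℕ.≤-reflexive (sym u≡))))

        u-idom-v : IsIdom A s uv v
        u-idom-v = u⊒v , strict-ancestor-≢ u>v , z⊒u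
          where
          z⊒u : ∀ z → Dom z v → z ≢ v → Dom z uv
          z⊒u z z⊒v z≢v with z ≟ uv
          ... | yes refl = dom-refl z
          ... | no z≢u   = dom-lift (strict⇒ancestor u>v) z⊒v
            (¬unprocessed≤processed (ℕ.≤-reflexive u≡) (strict-dominator-unprocessed z v v-present (z⊒v , z≢v)) z≢u)

        pv⊏⇒v⊏ : ∀ x → StrictlyDominates x pv → StrictlyDominates x v
        pv⊏⇒v⊏ x (x⊒pv , _) = dom-trans x⊒u u⊒v , x≢v
          where
          x⊒u : Dom x uv
          x⊒u = subst (Dom x) (sym u≡pv) x⊒pv
          x≢v : x ≢ v
          x≢v x≡v = strict-ancestor-≢ u>v
            (ancestor-antisym (dominator⇒ancestor u⊒v) (dominator⇒ancestor (subst (λ z → Dom z uv) x≡v x⊒u)))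

        pv⊐v : StrictlyDominates pv v
        pv⊐v = subst (λ z → Dom z v) u≡pv u⊒v , pv≢v

        d′ : V → Maybe V
        d′ w = if same σ v w then just uv else d σ w

        assigned-kept : ∀ {w} → Assigned (rep σ) (same σ) (d σ) w → Assigned rep′ (same σ) d′ w
        assigned-kept {w} α = record
          { idom       = idom
          ; d≡idom     = trans (cong (λ t → if t then just uv else d σ w) (in-no-same v v-present)) d≡idom
          ; is-idom    = is-idom
          ; in-no-same = λ v′ present′ → in-no-same v′ (proj₁ (present′⇒present v′ present′))
          }
          where open Assigned α

        pending-settled : ∀ {w} (π : Pending (rep σ) (same σ) w) → Pending.owner π ≡ v → Assigned rep′ (same σ) d′ w
        pending-settled {w} π owner≡v = record
          { idom       = uv
          ; d≡idom     = cong (λ t → if t then just uv else d σ w)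
                             (subst (λ z → same σ z w ≡ true) owner≡v in-owner-same)
          ; is-idom    = idom-resp-same-strict-dominators
                           (subst (λ z → SameStrictDominators z w) owner≡v owner-same-sdom) u-idom-v
          ; in-no-same = λ v′ present′ → ¬-not λ in-v′ → proj₂ (present′⇒present v′ present′)
                           (trans (owner-unique v′ (proj₁ (present′⇒present v′ present′)) in-v′) owner≡v)
          }
          where open Pending π

        pending-kept : ∀ {w} (π : Pending (rep σ) (same σ) w) → Pending.owner π ≢ v → Pending rep′ (same σ) w
        pending-kept π owner≢v = record
          { owner           = owner
          ; owner-present   = present⇒present′ owner owner-present owner≢v
          ; owner≢s         = owner≢s
          ; in-owner-same   = in-owner-same
          ; owner-same-sdom = owner-same-sdom
          ; owner-unique    = λ v′ present′ → owner-unique v′ (proj₁ (present′⇒present v′ present′))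
          }
          where open Pending π

        resolved′ : ∀ w → w ≢ s → Assigned rep′ (same σ) d′ w ⊎ Pending rep′ (same σ) w
        resolved′ w w≢s with resolved w w≢s
        ... | inj₁ α = inj₁ (assigned-kept α)
        ... | inj₂ π with Pending.owner π ≟ v
        ...   | yes owner≡v = inj₁ (pending-settled π owner≡v)
        ...   | no  owner≢v = inj₂ (pending-kept π owner≢v)

      -- All strict dominators of v and of p(v) are unprocessed, whereas p(v) and the representatives of
      -- the sources of arcs into v are processed ancestors of v; so v and p(v) have the same strict dominators.
      module MergeCase (u≢pv : uv ≢ pv) where
        u>pv : StrictAncestor uv pv
        u>pv = [ (λ u≡pv → ⊥-elim (u≢pv u≡pv)) , (λ u>pv → u>pv) ]′ u≡pv⊎u>pv

        pv<u : toℕ pv < u σ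
        pv<u = subst (toℕ pv <_) u≡ (strict-ancestor-> u>pv)

        v⊏⇒pv⊏ : ∀ x → StrictlyDominates x v → StrictlyDominates x pv
        v⊏⇒pv⊏ x x⊐v =
          dom-lift (strict⇒ancestor pv>v) (proj₁ x⊐v) (¬unprocessed≤processed (ℕ.<⇒≤ pv<u) u≤x x≢pv) , x≢pv
          where
          u≤x : u σ ≤ toℕ x
          u≤x = strict-dominator-unprocessed x v v-present x⊐v
          x≢pv : x ≢ pv
          x≢pv x≡pv = ℕ.<-irrefl refl (ℕ.<-≤-trans pv<u (subst (λ z → u σ ≤ toℕ z) x≡pv u≤x))

        pv⊏⇒v⊏ : ∀ x → StrictlyDominates x pv → StrictlyDominates x v
        pv⊏⇒v⊏ x x⊐pv = dom-from-preds v≢s x⊒pred , x≢v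
          where
          u≤x : u σ ≤ toℕ x
          u≤x = strict-dominator-unprocessed x pv pv-present x⊐pv
          x≢v : x ≢ v
          x≢v x≡v = ℕ.<-irrefl refl (ℕ.<-≤-trans v<u (subst (λ z → u σ ≤ toℕ z) x≡v u≤x))
          x⊒pred : ∀ a′ → Arc A a′ v → Dom x a′
          x⊒pred a′ arc with x ≟ rep σ a′
          ... | yes x≡ra = subst (λ z → Dom z a′) (sym x≡ra)
                             (unprocessed-rep-dominates a′ (subst (λ z → u σ ≤ toℕ z) x≡ra u≤x))
          ... | no x≢ra  = dom-rep⇒dom a′ x
            (dom-lift (in-arc-source≥pv a′ arc) (proj₁ x⊐pv)
                      (¬unprocessed≤processed (proj₂ (proj₂ (in-arc-source a′ arc))) u≤x x≢ra) , x≢ra)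

        pv-same-sdom-v : SameStrictDominators pv v
        pv-same-sdom-v = pv⊏⇒v⊏ , v⊏⇒pv⊏

        pv-processed-strictly : u σ ≤ toℕ pv → StrictlyDominates pv v
        pv-processed-strictly u≤pv = ⊥-elim (ℕ.<-irrefl refl (ℕ.<-≤-trans pv<u u≤pv))

        same′ : V → V → Bool
        same′ x w = if ⌊ x ≟ pv ⌋ then (same σ x w ∨ same σ v w) else same σ x w

        root-same-empty′ : ∀ w → w ≢ s → same′ s w ≡ false
        root-same-empty′ w w≢s = trans (if-≟-no (λ s≡pv → proj₁ u>pv (sym s≡pv))) (root-same-empty w w≢s)

        same′-⊇ : ∀ x w → same σ x w ≡ true → same′ x w ≡ true
        same′-⊇ x w in-x with x ≟ pv
        ... | yes _ rewrite in-x = refl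
        ... | no  _ = in-x

        same′-⊆ : ∀ x w → same′ x w ≡ true → same σ x w ≡ true ⊎ same σ v w ≡ true
        same′-⊆ x w in-x′ with x ≟ pv
        ... | yes _ = ∨≡true⁻ (same σ x w) in-x′
        ... | no  _ = inj₁ in-x′

        assigned-kept : ∀ {w} → Assigned (rep σ) (same σ) (d σ) w → Assigned rep′ same′ (d σ) w
        assigned-kept {w} α = record
          { idom       = idom
          ; d≡idom     = d≡idom
          ; is-idom    = is-idom
          ; in-no-same = λ v′ present′ → ¬-not λ in-v′ →
              [ not-¬ (in-no-same v′ (proj₁ (present′⇒present v′ present′))) , not-¬ (in-no-same v v-present) ]′
              (same′-⊆ v′ w in-v′)
          }
          where open Assigned α

        pending-moved : ∀ {w} (π : Pending (rep σ) (same σ) w) → Pending.owner π ≡ v → Pending rep′ same′ w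
        pending-moved {w} π owner≡v = record
          { owner           = pv
          ; owner-present   = present⇒present′ pv pv-present pv≢v
          ; owner≢s         = proj₁ u>pv
          ; in-owner-same   = trans (if-≟-yes {x = pv} refl) (trans (cong (same σ pv w ∨_) in-v) (∨-zeroʳ (same σ pv w)))
          ; owner-same-sdom = same-strict-dominators-trans pv-same-sdom-v
                                (subst (λ z → SameStrictDominators z w) owner≡v owner-same-sdom)
          ; owner-unique    = unique
          }
          where
          open Pending π
          in-v : same σ v w ≡ true
          in-v = subst (λ z → same σ z w ≡ true) owner≡v in-owner-same
          unique : ∀ v′ → rep′ v′ ≡ v′ → same′ v′ w ≡ true → v′ ≡ pv
          unique v′ present′ in-v′ with v′ ≟ pv
          ... | yes v′≡pv = v′≡pv
          ... | no  _     = ⊥-elim (proj₂ (present′⇒present v′ present′)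
                              (trans (owner-unique v′ (proj₁ (present′⇒present v′ present′)) in-v′) owner≡v))

        pending-kept : ∀ {w} (π : Pending (rep σ) (same σ) w) → Pending.owner π ≢ v → Pending rep′ same′ w
        pending-kept {w} π owner≢v = record
          { owner           = owner
          ; owner-present   = present⇒present′ owner owner-present owner≢v
          ; owner≢s         = owner≢s
          ; in-owner-same   = same′-⊇ owner w in-owner-same
          ; owner-same-sdom = owner-same-sdom
          ; owner-unique    = λ v′ present′ in-v′ →
              [ owner-unique v′ (proj₁ (present′⇒present v′ present′))
              , (λ in-v → ⊥-elim (owner≢v (sym (owner-unique v v-present in-v)))) ]′ (same′-⊆ v′ w in-v′)
          }
          where open Pending π

        resolved′ : ∀ w → w ≢ s → Assigned rep′ same′ (d σ) w ⊎ Pending rep′ same′ w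
        resolved′ w w≢s with resolved w w≢s
        ... | inj₁ α = inj₁ (assigned-kept α)
        ... | inj₂ π with Pending.owner π ≟ v
        ...   | yes owner≡v = inj₂ (pending-moved π owner≡v)
        ...   | no  owner≢v = inj₂ (pending-kept π owner≢v)

      tree-preserves : uv ≡ pv → Invariant (contract (assignD σ uv v) mk′ v)
      tree-preserves u≡pv = record
        { u≤n = u≤n ; root-present = root-present′ ; rep-present = rep-present′ ; rep-ancestor = rep-ancestor′
        ; par-present = par-present′ ; par-strict-ancestor = par-strict-ancestor′ ; par-nearest = par-nearest′
        ; absorbed-processed = absorbed-processed′ ; unprocessed-present = unprocessed-present′
        ; unmarked-in-arc = unmarked-in-arc′ ; unmarked-target-present = unmarked-target-present′
        ; marked-arc-ancestor = marked-arc-ancestor′ ; marked-arc-processed = marked-arc-processed′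
        ; processed-dominated-absent = processed-dominated-absent′
        ; dom-rep⇒dom = dom-rep⇒dom′ pv⊏⇒v⊏
        ; unprocessed-rep-dominates = unprocessed-rep-dominates′ (λ _ → pv⊐v)
        ; root-same-empty = root-same-empty ; resolved = resolved′
        }
        where
        open TreeCase u≡pv

      merge-preserves : uv ≢ pv → Invariant (contract (mergeSame σ v) mk′ v)
      merge-preserves u≢pv = record
        { u≤n = u≤n ; root-present = root-present′ ; rep-present = rep-present′ ; rep-ancestor = rep-ancestor′
        ; par-present = par-present′ ; par-strict-ancestor = par-strict-ancestor′ ; par-nearest = par-nearest′
        ; absorbed-processed = absorbed-processed′ ; unprocessed-present = unprocessed-present′
        ; unmarked-in-arc = unmarked-in-arc′ ; unmarked-target-present = unmarked-target-present′
        ; marked-arc-ancestor = marked-arc-ancestor′ ; marked-arc-processed = marked-arc-processed′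
        ; processed-dominated-absent = processed-dominated-absent′
        ; dom-rep⇒dom = dom-rep⇒dom′ pv⊏⇒v⊏
        ; unprocessed-rep-dominates = unprocessed-rep-dominates′ pv-processed-strictly
        ; root-same-empty = root-same-empty′ ; resolved = resolved′
        }
        where
        open MergeCase u≢pv

    private
      strict⇒current-ancestor-within : ∀ k {c b} → toℕ c ≤ toℕ b + k → Present σ c → Present σ b → b ≢ s →
        StrictAncestor c b → c ≡ par σ b ⊎ ProperAncestor σ c (par σ b)
      strict⇒current-ancestor-within zero {c} {b} c≤b _ _ _ c>b =
        ⊥-elim (ℕ.<-irrefl refl (ℕ.<-≤-trans (strict-ancestor-> c>b) (subst (toℕ c ≤_) (ℕ.+-identityʳ (toℕ b)) c≤b)))
      strict⇒current-ancestor-within (suc k) {c} {b} c≤b+k c-present b-present b≢s c>b with c ≟ par σ b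
      ... | yes c≡pb = inj₁ c≡pb
      ... | no  c≢pb = extend (strict⇒current-ancestor-within k c≤pb+k c-present pb-present pb≢s c>pb)
        where
        pb-present : Present σ (par σ b)
        pb-present = par-present b b-present b≢s
        c>pb : StrictAncestor c (par σ b)
        c>pb = ancestor⇒strict (par-nearest b c b-present b≢s c-present c>b) c≢pb
        pb≢s : par σ b ≢ s
        pb≢s = proj₁ c>pb
        c≤pb+k : toℕ c ≤ toℕ (par σ b) + k
        c≤pb+k = ℕ.≤-trans c≤b+k (subst (_≤ toℕ (par σ b) + k) (sym (ℕ.+-suc (toℕ b) k))
                   (ℕ.+-monoˡ-≤ k (strict-ancestor-> (par-strict-ancestor b b-present b≢s))))
        extend : c ≡ par σ (par σ b) ⊎ ProperAncestor σ c (par σ (par σ b)) → c ≡ par σ b ⊎ ProperAncestor σ c (par σ b)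
        extend (inj₁ c≡ppb) = inj₂ [ pb≢s , pb-present , sym c≡ppb ]
        extend (inj₂ c≫ppb) = inj₂ (c≫ppb ∷ʳ (pb≢s , pb-present , refl))

    strict⇒current-ancestor : ∀ {c b} → Present σ c → Present σ b → b ≢ s →
      StrictAncestor c b → c ≡ par σ b ⊎ ProperAncestor σ c (par σ b)
    strict⇒current-ancestor {c} {b} = strict⇒current-ancestor-within (toℕ c) (ℕ.m≤n+m (toℕ c) (toℕ b))

    module Advance {uv : V} (u≡ : toℕ uv ≡ u σ)
                   (no-candidate : ¬ (Σ V λ v → Σ V λ a → Σ V λ b → Candidate σ uv v a b)) where
      u-present : Present σ uv
      u-present = unprocessed-present uv (ℕ.≤-reflexive (sym u≡))

      -- Otherwise the representative t of x is a present proper descendant of u dominated by u; its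
      -- unmarked in-arc starts (inductively) in a vertex contracted into u: an unmarked tree or forward arc out of u.
      dominated⇒absorbed : ∀ x → Acc (TransClosure (Arc A)) x → Dom uv x → rep σ x ≡ uv
      dominated⇒absorbed x (acc rec) u⊒x with rep σ x ≟ uv
      ... | yes rx≡u = rx≡u
      ... | no  rx≢u = ⊥-elim (no-candidate (t , a′ , t , (arc , ra′≡u , rep-present x) , unmarked , tree⊎forward))
        where
        t : V
        t = rep σ x
        u≥t : Ancestor uv t
        u≥t with ancestors-comparable (dominator⇒ancestor u⊒x) (rep-ancestor x) | absorbed-processed x
        ... | inj₁ u≥t | _         = u≥t
        ... | inj₂ t≥u | inj₁ x-present = ⊥-elim (rx≢u (trans x-present
                (ancestor-antisym (subst (λ z → Ancestor z uv) x-present t≥u) (dominator⇒ancestor u⊒x))))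
        ... | inj₂ t≥u | inj₂ t≤u  = ⊥-elim (rx≢u (ancestor-≤⇒≡ t≥u (subst (toℕ t ≤_) (sym u≡) t≤u)))
        u>t : StrictAncestor uv t
        u>t = ancestor⇒strict u≥t (λ u≡t → rx≢u (sym u≡t))
        t≢s : t ≢ s
        t≢s = proj₁ u>t
        u⊒t : Dom uv t
        u⊒t = dom-lift (rep-ancestor x) u⊒x (λ t≥u → rx≢u (ancestor-antisym t≥u u≥t))
        in-arc : Σ V λ a′ → Arc A a′ t × mark σ a′ t ≡ false
        in-arc = unmarked-in-arc t (rep-present x) t≢s
        a′ : V
        a′ = proj₁ in-arc
        arc : Arc A a′ t
        arc = proj₁ (proj₂ in-arc)
        unmarked : mark σ a′ t ≡ false
        unmarked = proj₂ (proj₂ in-arc)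
        ra′≡u : rep σ a′ ≡ uv
        ra′≡u = dominated⇒absorbed a′ (rec (arc◅star⇒⁺ arc (path⇒star (tree-path (rep-ancestor x)))))
                  (dom-pred u⊒t (λ u≡t → rx≢u (sym u≡t)) arc)
        tree⊎forward : TreeArc σ uv t ⊎ ForwardArc σ uv t
        tree⊎forward = [ (λ u≡pt → inj₁ (t≢s , u≡pt)) , (λ u≫pt → inj₂ (t≢s , u≫pt)) ]′
                         (strict⇒current-ancestor u-present (rep-present x) t≢s u>t)

      advance-preserves : Invariant (record σ { u = suc (u σ) })
      advance-preserves = record
        { u≤n = s≤s (subst (_≤ m) u≡ (ℕ.≤-pred (toℕ<n uv)))
        ; root-present = root-present ; rep-present = rep-present ; rep-ancestor = rep-ancestor
        ; par-present = par-present ; par-strict-ancestor = par-strict-ancestor ; par-nearest = par-nearest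
        ; absorbed-processed = λ x → [ inj₁ , (λ rx≤u → inj₂ (ℕ.m≤n⇒m≤1+n rx≤u)) ]′ (absorbed-processed x)
        ; unprocessed-present = λ x u<x → unprocessed-present x (ℕ.<⇒≤ u<x)
        ; unmarked-in-arc = unmarked-in-arc ; unmarked-target-present = unmarked-target-present
        ; marked-arc-ancestor = marked-arc-ancestor
        ; marked-arc-processed = λ a b arc marked → ℕ.m≤n⇒m≤1+n (marked-arc-processed a b arc marked)
        ; processed-dominated-absent = processed-dominated-absent′
        ; dom-rep⇒dom = dom-rep⇒dom
        ; unprocessed-rep-dominates = λ a u<ra → unprocessed-rep-dominates a (ℕ.<⇒≤ u<ra)
        ; root-same-empty = root-same-empty ; resolved = resolved
        }
        where
        processed-dominated-absent′ : ∀ D x → toℕ D < suc (u σ) → StrictlyDominates D x → ¬ Present σ x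
        processed-dominated-absent′ D x D≤u D⊐x x-present with toℕ D ℕ.<? u σ
        ... | yes D<u = processed-dominated-absent D x D<u D⊐x x-present
        ... | no  D≮u = proj₂ D⊐x (trans D≡u (sym (trans (sym x-present)
                          (dominated⇒absorbed x (reachability-wellFounded x) (subst (λ z → Dom z x) D≡u (proj₁ D⊐x))))))
          where
          D≡u : D ≡ uv
          D≡u = toℕ-injective (trans (ℕ.≤-antisym (ℕ.≤-pred D≤u) (ℕ.≮⇒≥ D≮u)) (sym u≡))

  step-preserves : ∀ {σ σ′} → Invariant σ → Step σ σ′ → Invariant σ′
  step-preserves I (markOnly  _ _ _ _ _ u≡ cand ¬all)      = Preservation.mark-only-preserves I u≡ cand ¬all
  step-preserves I (markTree  _ _ _ _ _ u≡ cand all u≡pv)  = Preservation.Contraction.tree-preserves I u≡ cand all u≡pv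
  step-preserves I (markOther _ _ _ _ _ u≡ cand all u≢pv)  = Preservation.Contraction.merge-preserves I u≡ cand all u≢pv
  step-preserves I (advance   _ _ u≡ none)                 = Preservation.Advance.advance-preserves I u≡ none

  run-preserves : ∀ {σ σ′} → Invariant σ → Star Step σ σ′ → Invariant σ′
  run-preserves I ε           = I
  run-preserves I (step ◅ run) = run-preserves (step-preserves I step) run

  -- Existence of a candidate arc is not decided constructively here; excluded middle is harmless as the goal is ⊥.
  stuck⇒finished : ∀ σ → Invariant σ → (∀ σ′ → ¬ Step σ σ′) → u σ ≡ suc m
  stuck⇒finished σ I stuck with u σ ℕ.<? suc m
  ... | no  u≮n = ℕ.≤-antisym (Invariant.u≤n I) (ℕ.≮⇒≥ u≮n)
  ... | yes u<n = ⊥-elim (¬¬-excluded-middle λ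
          { (no none) → stuck _ (advance σ uv u≡ none)
          ; (yes (v , a , b , cand)) → ¬¬-excluded-middle λ
              { (no ¬all) → stuck _ (markOnly σ uv v a b u≡ cand ¬all)
              ; (yes all) → case uv ≟ par σ v of λ
                  { (yes u≡pv) → stuck _ (markTree σ uv v a b u≡ cand all u≡pv)
                  ; (no  u≢pv) → stuck _ (markOther σ uv v a b u≡ cand all u≢pv) } } })
    where
    uv : V
    uv = fromℕ< u<n
    u≡ : toℕ uv ≡ u σ
    u≡ = toℕ-fromℕ< u<n

  finished⇒assigned : ∀ {σ} → Invariant σ → u σ ≡ suc m → ∀ w → w ≢ s → Assigned (rep σ) (same σ) (d σ) w
  finished⇒assigned {σ} I finished w w≢s with Invariant.resolved I w w≢s
  ... | inj₁ α = α
  ... | inj₂ π = ⊥-elim (Invariant.processed-dominated-absent I s owner s<u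
                           (dom-source owner , λ s≡owner → owner≢s (sym s≡owner)) owner-present)
    where
    open Pending π
    s<u : toℕ s < u σ
    s<u = subst (_< _) (sym (toℕ-fromℕ m)) (subst (m <_) (sym finished) (ℕ.n<1+n m))

  unmarked-count : (V → V → Bool) → ℕ
  unmarked-count mk = ∑ λ x → ∑ λ y → if mk x y then 0 else 1

  setMark-decreases-count : ∀ mk a b → mk a b ≡ false → unmarked-count (setMark mk a b) < unmarked-count mk
  setMark-decreases-count mk a b unmarked =
    ∑-mono-< (λ x → ∑-mono-≤ (pointwise x)) a (∑-mono-< (pointwise a) b at-ab)
    where
    pointwise : ∀ x y → (if setMark mk a b x y then 0 else 1) ≤ (if mk x y then 0 else 1)
    pointwise x y with setMark mk a b x y in e
    ... | true  = z≤n
    ... | false rewrite setMark-false mk a b x y e = ℕ.≤-refl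
    at-ab : (if setMark mk a b a b then 0 else 1) < (if mk a b then 0 else 1)
    at-ab rewrite setMark-hit mk a b | unmarked = ℕ.n<1+n 0

  measure : State → ℕ × ℕ
  measure σ = suc m ∸ u σ , unmarked-count (mark σ)

  private
    marking-decreases : ∀ σ {uv v} a b → Candidate σ uv v a b →
      unmarked-count (setMark (mark σ) a b) < unmarked-count (mark σ)
    marking-decreases σ a b (_ , unmarked , _) = setMark-decreases-count (mark σ) a b unmarked

  step-decreases : ∀ {σ σ′} → Step σ σ′ → ×-Lex _≡_ _<_ _<_ (measure σ′) (measure σ)
  step-decreases (markOnly  σ _ _ a b _ cand _)   = inj₂ (refl , marking-decreases σ a b cand)
  step-decreases (markTree  σ _ _ a b _ cand _ _) = inj₂ (refl , marking-decreases σ a b cand)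
  step-decreases (markOther σ _ _ a b _ cand _ _) = inj₂ (refl , marking-decreases σ a b cand)
  step-decreases (advance   σ uv u≡ _) =
    inj₁ (ℕ.∸-monoʳ-< (ℕ.n<1+n (u σ)) (s≤s (subst (_≤ m) u≡ (ℕ.≤-pred (toℕ<n uv)))))

  steps-wellFounded : WellFounded (λ σ′ σ → Step σ σ′)
  steps-wellFounded = Subrelation.wellFounded step-decreases
    (On.wellFounded measure (×-wellFounded <-wellFounded <-wellFounded))

theorem1 : (m : ℕ) (A : Fin (suc m) → Fin (suc m) → Bool) (p : Fin (suc m) → Fin (suc m)) →
    IsFlowGraph m A → Acyclic A → IsBottomUpSpanningTree m A p →
    Acc (λ σ' σ → AD.Step m A p σ σ') (AD.initial m A p) ×
    ((σ : AD.State m A p) → Star (AD.Step m A p) (AD.initial m A p) σ →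
      ((σ' : AD.State m A p) → ¬ AD.Step m A p σ σ') →
      AD.u σ ≡ suc m ×
      ((w : Fin (suc m)) → w ≢ fromℕ m →
        Σ (Fin (suc m)) λ i → AD.d σ w ≡ just i × IsIdom A (fromℕ m) i w))
theorem1 m A p _ acyclic tree = steps-wellFounded _ , λ σ run stuck →
  let I        = run-preserves initial-invariant run
      finished = stuck⇒finished σ I stuck
  in finished , λ w w≢s → let open Assigned (finished⇒assigned I finished w w≢s) in idom , d≡idom , is-idom
  where
  open Correctness m A p acyclic tree
  open AD m A p using (initial)
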